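{- Consider the random experiment below with $\ell\ge300000\log^3(n)$. For any $k\ge0$ and any $C\in\mathcal{C}^{(\ge k)}$ we have $$\sum_{C'\in\mathcal{C}^{(k)}}|C'\cap C\cap R_k|\le\frac{10}{\ell^k}\Big(|C|+\sum_{C'\in\mathcal{C}^{(k)}}|C'\cap C|\Big)$$ with probability at least $1-1/n^{10}$.
   Context: Let $\mathcal{H}=(P\cup R,\mathcal{C})$ be a hypergraph whose configurations each contain exactly one player, $n=|R|$, and $\ell$ an integer such that each resource lies in at most $\ell$ configurations (counted with multiplicity). For a configuration $C$ write $|C|$ for $|C\cap R|$, and intersections $|C'\cap C|$ are counted on resources. Let $\mathcal{C}^{(0)}$ be the configurations of size in $[0,\ell^4)$ and, for $k\ge1$, $\mathcal{C}^{(k)}$ those of size in $[\ell^{k+3},\ell^{k+4})$; $\mathcal{C}^{(\ge k)}=\bigcup_{h\ge k}\mathcal{C}^{(h)}$; $d$ is the smallest number with $\mathcal{C}^{(\ge d)}=\emptyset$. Random experiment: $R=R_0\supseteq R_1\supseteq\cdots\supseteq R_d$, where $R_k$ is obtained from $R_{k-1}$ by deleting each resource independently with probability $(\ell-1)/\ell$. -}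

module Defs where

open import Data.Bool using (Bool; true; false; _∧_; if_then_else_)
open import Data.Nat as ℕ using (ℕ; zero; suc; _+_; _*_; _^_; _≤_; _<_; _!; _≤ᵇ_; _<ᵇ_; NonZero)
open import Data.Nat.Properties using (_!≢0; m^n≢0)
open import Data.Fin using (Fin; zero; suc)
open import Data.Fin.Subset using (Subset; _∈_; _∩_; ∣_∣)
open import Data.Fin.Subset.Properties using (_∈?_)
open import Data.Vec using (tabulate)
open import Data.List using (List; []; _∷_; map; concatMap; foldr; filter; allFin)
open import Data.Product using (_×_; _,_; ∃-syntax)
open import Data.Integer using (+_)
open import Data.Rational as ℚ using (ℚ)
import Data.Vec.Functional as VF
import Data.List
open import Relation.Binary.PropositionalEquality using (_≡_)

-- Natural logarithm, via the exponential series.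
-- expSum N q = Σ_{i<N} q^i / i!.  For rational q ≥ 0 we have
-- exp q ≤ x  iff  ∀ N, expSum N q ≤ x.

powℚ : ℚ → ℕ → ℚ
powℚ q zero    = ℚ.1ℚ
powℚ q (suc k) = q ℚ.* powℚ q k

expSum : ℕ → ℚ → ℚ
expSum zero    q = ℚ.0ℚ
expSum (suc N) q = expSum N q ℚ.+ powℚ q N ℚ.* ((+ 1 ℚ./ (N !)) {{N !≢0}})

-- "c * (ln n)^3 ≤ ℓ" : every rational q ≥ 0 with exp q ≤ n satisfies
-- c * q^3 ≤ ℓ  (since ln n = sup { q ≥ 0 | exp q ≤ n } for n ≥ 1).
LnCubeBound : (c n ℓ : ℕ) → Set
LnCubeBound c n ℓ =
  ∀ (q : ℚ) → ℚ.0ℚ ℚ.≤ q → (∀ N → expSum N q ℚ.≤ (+ n ℚ./ 1)) →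
  (+ c ℚ./ 1) ℚ.* powℚ q 3 ℚ.≤ (+ ℓ ℚ./ 1)

-- Hypergraph: configurations each contain exactly one player (a player
-- field) and a set of resources among R = Fin n.

record Config (m n : ℕ) : Set where
  constructor config
  field
    player : Fin m
    res    : Subset n
open Config public

degree : ∀ {m n c} → (Fin c → Config m n) → Fin n → ℕ
degree {c = c} 𝒞 r = Data.List.length (filter (λ i → r ∈? res (𝒞 i)) (allFin c))

-- |C| = |C ∩ R|
size : ∀ {m n} → Config m n → ℕ
size C = ∣ res C ∣

inClass : (ℓ k s : ℕ) → Bool
inClass ℓ zero    s = s <ᵇ ℓ ^ 4
inClass ℓ (suc j) s = (ℓ ^ (suc j + 3) ≤ᵇ s) ∧ (s <ᵇ ℓ ^ (suc j + 4))

InAtLeast : (ℓ k s : ℕ) → Set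
InAtLeast ℓ k s = ∃[ h ] (k ≤ h × inClass ℓ h s ≡ true)

EmptyFrom : ∀ {m n c} → (ℓ : ℕ) → (Fin c → Config m n) → ℕ → Set
EmptyFrom ℓ 𝒞 k = ∀ i → InAtLeast ℓ k (size (𝒞 i)) → Data.Empty.⊥
  where import Data.Empty

IsDepth : ∀ {m n c} → (ℓ : ℕ) → (Fin c → Config m n) → ℕ → Set
IsDepth ℓ 𝒞 d = EmptyFrom ℓ 𝒞 d × (∀ d' → d' < d → EmptyFrom ℓ 𝒞 d' → Data.Empty.⊥)
  where import Data.Empty

Dist : Set → Set
Dist A = List (A × ℚ)

powDist : ∀ {A : Set} (k : ℕ) → Dist A → Dist (Fin k → A)
powDist zero    D = ((λ ()) , ℚ.1ℚ) ∷ []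
powDist (suc k) D =
  concatMap (λ { (a , p) → map (λ { (f , q) → (a VF.∷ f) , p ℚ.* q }) (powDist k D) }) D

Pr : ∀ {A : Set} → Dist A → (A → Bool) → ℚ
Pr D E = foldr (λ { (a , p) acc → (if E a then p else ℚ.0ℚ) ℚ.+ acc }) ℚ.0ℚ D

coin : (ℓ : ℕ) → .{{NonZero ℓ}} → Dist Bool
coin ℓ = (true , + 1 ℚ./ ℓ) ∷ (false , ℚ.1ℚ ℚ.- (+ 1 ℚ./ ℓ)) ∷ []

-- The experiment: for each resource r and each step j ∈ {1..d} (index j : Fin d)
-- an independent coin ω r j; true = survives step j+1.
Outcome : ℕ → ℕ → Set
Outcome n d = Fin n → Fin d → Bool

experiment : (n d ℓ : ℕ) → .{{NonZero ℓ}} → Dist (Outcome n d)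
experiment n d ℓ = powDist n (powDist d (coin ℓ))

survives : ∀ {d} → ℕ → (Fin d → Bool) → Bool
survives {zero}  k       f = true
survives {suc d} zero    f = true
survives {suc d} (suc k) f = f zero ∧ survives k (λ j → f (suc j))

Rk : ∀ {n d} → Outcome n d → ℕ → Subset n
Rk ω k = tabulate (λ r → survives k (ω r))

sumℕ : List ℕ → ℕ
sumℕ = foldr _+_ 0

sumClass : ∀ {m n c} → (ℓ k : ℕ) → (Fin c → Config m n) → (Config m n → ℕ) → ℕ
sumClass {c = c} ℓ k 𝒞 f =
  sumℕ (map (λ i → f (𝒞 i)) (filter (λ i → Data.Bool._≟_ (inClass ℓ k (size (𝒞 i))) true) (allFin c)))
  where import Data.Bool

-- The event:  Σ_{C'∈𝒞^(k)} |C' ∩ C ∩ R_k| ≤ (10/ℓ^k)(|C| + Σ_{C'∈𝒞^(k)} |C' ∩ C|),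
-- written after multiplying both sides by ℓ^k > 0.
goodEvent : ∀ {m n c d} → (ℓ k : ℕ) → (Fin c → Config m n) → Config m n → Outcome n d → Bool
goodEvent ℓ k 𝒞 C ω =
  (ℓ ^ k) * sumClass ℓ k 𝒞 (λ C' → ∣ res C' ∩ res C ∩ Rk ω k ∣)
    ≤ᵇ 10 * (size C + sumClass ℓ k 𝒞 (λ C' → ∣ res C' ∩ res C ∣))

-- For k = 0 the event always holds. For k ≥ 1 let u_r ≤ ℓ count the class-k configurations
-- meeting C in the resource r, so that X = ℓ^k Σ_{C′} |C′ ∩ C ∩ R_k| = Σ_r ℓ^k u_r [r ∈ R_k].
-- With y = 1 + 1/(2ℓ^(k+1)), independence of the coins gives 𝔼 y^X ≤ y^(2 Σ_r u_r), whereas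
-- |C| ≥ ℓ^(k+3) and n ≤ 2^ℓ (a consequence of ℓ ≥ 300000 ln³ n) give y^(10|C|) ≥ n^10.
-- Markov's inequality for y^X then bounds the failure probability by n^(-10).
module Submission where

open import Defs
open import Data.Bool using (Bool; true; false; _∧_; T)
import Data.Bool as Bool
open import Data.Fin using (Fin; zero; suc)
open import Data.Fin.Subset using (Subset; _∩_; ∣_∣)
open import Data.Fin.Subset.Properties using (_∈?_; ∩-assoc; ∣p∩q∣≤∣p∣)
open import Data.Integer as ℤ using (+_)
import Data.Integer.Properties as ℤ
import Data.Integer.Solver as ℤ-Solver
open import Data.List using (List; []; _∷_; _++_; map; foldr; concatMap; filter; length; allFin)
open import Data.List.Relation.Unary.All using (All; []; _∷_)
import Data.List.Relation.Unary.All.Properties as All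
open import Data.Nat as ℕ using (ℕ; zero; suc; NonZero; _^_; _!; _≤_)
import Data.Nat.Properties as ℕ
open import Algebra.Properties.Semiring.Sum ℕ.+-*-semiring using (sum; sum-cong-≗; ∑-distrib-+; *-distribˡ-sum; sum-replicate-zero)
open import Data.Nat.Properties using (m^n≢0; _!≢0)
open import Data.Nat.Coprimality using (1-coprimeTo)
import Data.Nat.Coprimality as Coprime
import Data.Nat.Solver as ℕ-Solver
open import Data.Product using (_×_; _,_; proj₁; proj₂; ∃-syntax)
open import Data.Rational using (ℚ; mkℚ; _/_; 0ℚ; 1ℚ; _+_; _*_; _-_; -_; _<_) renaming (_≤_ to _≤ℚ_)
import Data.Rational as ℚ
open import Data.Rational.Properties
import Data.Rational.Solver as ℚ-Solver
import Data.Rational.Unnormalised as ℚᵘ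
import Data.Rational.Unnormalised.Properties as ℚᵘ
open import Data.Vec using ([]; _∷_; lookup)
import Data.Vec.Functional as VF
open import Data.Vec.Properties using (lookup-zipWith; lookup∘tabulate; []=⇒lookup; lookup⇒[]=)
open import Relation.Binary.PropositionalEquality
open import Relation.Nullary using (Dec; yes; no; does; ¬_; contradiction)

fromℕ : ℕ → ℚ
fromℕ n = mkℚ (+ n) 0 (Coprime.sym (1-coprimeTo n))

fromℕ≡/1 : ∀ n → + n / 1 ≡ fromℕ n
fromℕ≡/1 n = normalize-coprime (Coprime.sym (1-coprimeTo n))

fromℕ-+ : ∀ a b → fromℕ (a ℕ.+ b) ≡ fromℕ a + fromℕ b
fromℕ-+ a b = toℚᵘ-injective (ℚᵘ.≃-trans (ℚᵘ.*≡* eq) (ℚᵘ.≃-sym (toℚᵘ-homo-+ (fromℕ a) (fromℕ b))))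
  where
  open ℤ-Solver.+-*-Solver
  eq : + (a ℕ.+ b) ℤ.* (+ 1 ℤ.* + 1) ≡ (+ a ℤ.* + 1 ℤ.+ + b ℤ.* + 1) ℤ.* + 1
  eq = trans (cong (ℤ._* (+ 1 ℤ.* + 1)) (ℤ.pos-+ a b))
    (solve 2 (λ x y → (x :+ y) :* (con (+ 1) :* con (+ 1)) := (x :* con (+ 1) :+ y :* con (+ 1)) :* con (+ 1)) refl (+ a) (+ b))

fromℕ-* : ∀ a b → fromℕ (a ℕ.* b) ≡ fromℕ a * fromℕ b
fromℕ-* a b = toℚᵘ-injective (ℚᵘ.≃-trans (ℚᵘ.*≡* eq) (ℚᵘ.≃-sym (toℚᵘ-homo-* (fromℕ a) (fromℕ b))))
  where
  open ℤ-Solver.+-*-Solver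
  eq : + (a ℕ.* b) ℤ.* (+ 1 ℤ.* + 1) ≡ (+ a ℤ.* + b) ℤ.* + 1
  eq = trans (cong (ℤ._* (+ 1 ℤ.* + 1)) (ℤ.pos-* a b))
    (solve 2 (λ x y → (x :* y) :* (con (+ 1) :* con (+ 1)) := (x :* y) :* con (+ 1)) refl (+ a) (+ b))

fromℕ-mono-≤ : ∀ {a b} → a ≤ b → fromℕ a ≤ℚ fromℕ b
fromℕ-mono-≤ {a} {b} a≤b =
  ℚ.*≤* (subst₂ ℤ._≤_ (sym (ℤ.*-identityʳ (+ a))) (sym (ℤ.*-identityʳ (+ b))) (ℤ.+≤+ a≤b))

fromℕ-cancel-≤ : ∀ {a b} → fromℕ a ≤ℚ fromℕ b → a ≤ b
fromℕ-cancel-≤ {a} {b} (ℚ.*≤* p) =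
  ℤ.drop‿+≤+ (subst₂ ℤ._≤_ (ℤ.*-identityʳ (+ a)) (ℤ.*-identityʳ (+ b)) p)

0≤fromℕ : ∀ n → 0ℚ ≤ℚ fromℕ n
0≤fromℕ n = fromℕ-mono-≤ ℕ.z≤n

0≤1 : 0ℚ ≤ℚ 1ℚ
0≤1 = 0≤fromℕ 1

fromℕ*1/n≡1 : ∀ n .{{_ : NonZero n}} → fromℕ n * (+ 1 / n) ≡ 1ℚ
fromℕ*1/n≡1 (suc n) =
  trans (cong (fromℕ (suc n) *_) (normalize-coprime (1-coprimeTo (suc n)))) (*-inverseʳ (fromℕ (suc n)))

0≤1/n : ∀ n .{{_ : NonZero n}} → 0ℚ ≤ℚ + 1 / n
0≤1/n n = nonNegative⁻¹ (+ 1 / n) {{normalize-nonNeg 1 n}}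

1/n≤1 : ∀ n .{{_ : NonZero n}} → + 1 / n ≤ℚ 1ℚ
1/n≤1 n = subst₂ _≤ℚ_ (*-identityˡ _) (fromℕ*1/n≡1 n)
  (*-monoʳ-≤-nonNeg (+ 1 / n) {{normalize-nonNeg 1 n}} (fromℕ-mono-≤ (ℕ.>-nonZero⁻¹ n)))

*-mono-≤-nonNeg : ∀ {a b c d} → 0ℚ ≤ℚ a → 0ℚ ≤ℚ c → a ≤ℚ b → c ≤ℚ d → a * c ≤ℚ b * d
*-mono-≤-nonNeg {a} {b} {c} {d} 0≤a 0≤c a≤b c≤d =
  ≤-trans (*-monoʳ-≤-nonNeg c {{ℚ.nonNegative 0≤c}} a≤b)
          (*-monoˡ-≤-nonNeg b {{ℚ.nonNegative (≤-trans 0≤a a≤b)}} c≤d)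

0≤* : ∀ {a b} → 0ℚ ≤ℚ a → 0ℚ ≤ℚ b → 0ℚ ≤ℚ a * b
0≤* {a} {b} 0≤a 0≤b = subst (_≤ℚ a * b) (*-zeroʳ a) (*-monoˡ-≤-nonNeg a {{ℚ.nonNegative 0≤a}} 0≤b)

p≤q⇒0≤q-p : ∀ {p q} → p ≤ℚ q → 0ℚ ≤ℚ q - p
p≤q⇒0≤q-p {p} {q} p≤q = subst (_≤ℚ q - p) (+-inverseʳ p) (+-monoˡ-≤ (- p) p≤q)

0≤q-p⇒p≤q : ∀ {p q} → 0ℚ ≤ℚ q - p → p ≤ℚ q
0≤q-p⇒p≤q {p} {q} 0≤q-p =
  subst₂ _≤ℚ_ (+-identityʳ p) (solve 2 (λ p q → p :+ (q :- p) := q) refl p q) (+-monoʳ-≤ p 0≤q-p)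
  where open ℚ-Solver.+-*-Solver

powℚ-+ : ∀ y a b → powℚ y (a ℕ.+ b) ≡ powℚ y a * powℚ y b
powℚ-+ y zero    b = sym (*-identityˡ _)
powℚ-+ y (suc a) b = trans (cong (y *_) (powℚ-+ y a b)) (sym (*-assoc y _ _))

powℚ-* : ∀ y a b → powℚ y (a ℕ.* b) ≡ powℚ (powℚ y a) b
powℚ-* y a zero    rewrite ℕ.*-zeroʳ a = refl
powℚ-* y a (suc b) rewrite ℕ.*-suc a b =
  trans (powℚ-+ y a (a ℕ.* b)) (cong (powℚ y a *_) (powℚ-* y a b))

powℚ-distrib-* : ∀ x y i → powℚ x i * powℚ y i ≡ powℚ (x * y) i
powℚ-distrib-* x y zero    = refl
powℚ-distrib-* x y (suc i) =
  trans (solve 4 (λ x y X Y → x :* X :* (y :* Y) := x :* y :* (X :* Y)) refl x y (powℚ x i) (powℚ y i))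
        (cong (x * y *_) (powℚ-distrib-* x y i))
  where open ℚ-Solver.+-*-Solver

powℚ-1 : ∀ i → powℚ 1ℚ i ≡ 1ℚ
powℚ-1 zero    = refl
powℚ-1 (suc i) = trans (*-identityˡ _) (powℚ-1 i)

powℚ-fromℕ : ∀ a b → powℚ (fromℕ a) b ≡ fromℕ (a ^ b)
powℚ-fromℕ a zero    = refl
powℚ-fromℕ a (suc b) = trans (cong (fromℕ a *_) (powℚ-fromℕ a b)) (sym (fromℕ-* a (a ^ b)))

0≤powℚ : ∀ {y} → 0ℚ ≤ℚ y → ∀ j → 0ℚ ≤ℚ powℚ y j
0≤powℚ 0≤y zero    = 0≤1
0≤powℚ 0≤y (suc j) = 0≤* 0≤y (0≤powℚ 0≤y j)

1≤powℚ : ∀ {y} → 1ℚ ≤ℚ y → ∀ j → 1ℚ ≤ℚ powℚ y j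
1≤powℚ 1≤y zero    = ≤-refl
1≤powℚ 1≤y (suc j) = *-mono-≤-nonNeg 0≤1 0≤1 1≤y (1≤powℚ 1≤y j)

powℚ-monoʳ-≤ : ∀ {y} → 1ℚ ≤ℚ y → ∀ {a b} → a ≤ b → powℚ y a ≤ℚ powℚ y b
powℚ-monoʳ-≤ {y} 1≤y {a} {b} a≤b = begin
  powℚ y a                        ≡⟨ *-identityʳ (powℚ y a) ⟨
  powℚ y a * 1ℚ                   ≤⟨ *-monoˡ-≤-nonNeg (powℚ y a) {{ℚ.nonNegative (0≤powℚ 0≤y a)}}
                                                      (1≤powℚ 1≤y (b ℕ.∸ a)) ⟩
  powℚ y a * powℚ y (b ℕ.∸ a)     ≡⟨ powℚ-+ y a (b ℕ.∸ a) ⟨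
  powℚ y (a ℕ.+ (b ℕ.∸ a))        ≡⟨ cong (powℚ y) (ℕ.m+[n∸m]≡n a≤b) ⟩
  powℚ y b                        ∎
  where
  open ≤-Reasoning
  0≤y : 0ℚ ≤ℚ y
  0≤y = ≤-trans 0≤1 1≤y

powℚ-monoˡ-≤ : ∀ {x y} → 0ℚ ≤ℚ x → x ≤ℚ y → ∀ j → powℚ x j ≤ℚ powℚ y j
powℚ-monoˡ-≤ 0≤x x≤y zero    = ≤-refl
powℚ-monoˡ-≤ 0≤x x≤y (suc j) = *-mono-≤-nonNeg 0≤x (0≤powℚ 0≤x j) x≤y (powℚ-monoˡ-≤ 0≤x x≤y j)

bernoulli : ∀ {t} → 0ℚ ≤ℚ t → ∀ j → 1ℚ + fromℕ j * t ≤ℚ powℚ (1ℚ + t) j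
bernoulli {t} 0≤t zero    = ≤-reflexive (trans (cong (_+_ 1ℚ) (*-zeroˡ t)) (+-identityʳ 1ℚ))
bernoulli {t} 0≤t (suc j) = begin
  1ℚ + fromℕ (suc j) * t              ≤⟨ 0≤q-p⇒p≤q (subst (0ℚ ≤ℚ_) (sym gap) (0≤* (0≤* (0≤fromℕ j) 0≤t) 0≤t)) ⟩
  (1ℚ + t) * (1ℚ + fromℕ j * t)       ≤⟨ *-monoˡ-≤-nonNeg (1ℚ + t) {{ℚ.nonNegative (+-mono-≤ 0≤1 0≤t)}}
                                                          (bernoulli 0≤t j) ⟩
  (1ℚ + t) * powℚ (1ℚ + t) j          ∎
  where
  open ≤-Reasoning
  open ℚ-Solver.+-*-Solver
  gap : (1ℚ + t) * (1ℚ + fromℕ j * t) - (1ℚ + fromℕ (suc j) * t) ≡ fromℕ j * t * t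
  gap = trans (cong (λ u → (1ℚ + t) * (1ℚ + fromℕ j * t) - (1ℚ + u * t)) (fromℕ-+ 1 j))
    (solve 2 (λ J t → (con 1ℚ :+ t) :* (con 1ℚ :+ J :* t) :- (con 1ℚ :+ (con 1ℚ :+ J) :* t) := J :* t :* t)
           refl (fromℕ j) t)

powℚ-1+t≤1+2jt : ∀ {t} → 0ℚ ≤ℚ t → ∀ j → fromℕ (2 ℕ.* j) * t ≤ℚ 1ℚ → powℚ (1ℚ + t) j ≤ℚ 1ℚ + fromℕ (2 ℕ.* j) * t
powℚ-1+t≤1+2jt {t} 0≤t zero    _ = ≤-reflexive (sym (trans (cong (_+_ 1ℚ) (*-zeroˡ t)) (+-identityʳ 1ℚ)))
powℚ-1+t≤1+2jt {t} 0≤t (suc j) small = begin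
  (1ℚ + t) * powℚ (1ℚ + t) j          ≤⟨ *-monoˡ-≤-nonNeg (1ℚ + t) {{ℚ.nonNegative (+-mono-≤ 0≤1 0≤t)}}
                                                          (powℚ-1+t≤1+2jt 0≤t j small′) ⟩
  (1ℚ + t) * (1ℚ + c * t)             ≤⟨ 0≤q-p⇒p≤q (subst (0ℚ ≤ℚ_) (sym gap) (0≤* 0≤t (p≤q⇒0≤q-p small′))) ⟩
  1ℚ + fromℕ (2 ℕ.* suc j) * t        ∎
  where
  open ≤-Reasoning
  open ℚ-Solver.+-*-Solver
  c : ℚ
  c = fromℕ (2 ℕ.* j)
  small′ : c * t ≤ℚ 1ℚ
  small′ = ≤-trans (*-monoʳ-≤-nonNeg t {{ℚ.nonNegative 0≤t}} (fromℕ-mono-≤ (ℕ.*-monoʳ-≤ 2 (ℕ.n≤1+n j)))) small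
  gap : 1ℚ + fromℕ (2 ℕ.* suc j) * t - (1ℚ + t) * (1ℚ + c * t) ≡ t * (1ℚ - c * t)
  gap = trans (cong (λ u → 1ℚ + u * t - (1ℚ + t) * (1ℚ + c * t))
                    (trans (cong fromℕ (ℕ.*-suc 2 j)) (fromℕ-+ 2 (2 ℕ.* j))))
    (solve 2 (λ J t → con 1ℚ :+ (con 1ℚ :+ con 1ℚ :+ J) :* t :- (con 1ℚ :+ t) :* (con 1ℚ :+ J :* t) := t :* (con 1ℚ :- J :* t))
           refl c t)

half : ℚ
half = + 1 / 2

invFactorial : ℕ → ℚ
invFactorial N = (+ 1 / (N !)) {{N !≢0}}

-- The hypothesis says q^i/i! ≤ K 2^(-i): the series is dominated by a geometric one.
expSum-geometric : ∀ q K → 0ℚ ≤ℚ K → (∀ i → powℚ (fromℕ 2 * q) i ≤ℚ K * fromℕ (i !)) →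
                   ∀ N → expSum N q ≤ℚ K * fromℕ 2
expSum-geometric q K 0≤K [2q]^i≤K*i! N = begin
  expSum N q                                   ≤⟨ ≤-reflexive (sym (+-identityʳ _)) ⟩
  expSum N q + 0ℚ                              ≤⟨ +-monoʳ-≤ (expSum N q) (0≤* 0≤K (0≤* (0≤fromℕ 2) (0≤powℚ (0≤1/n 2) N))) ⟩
  expSum N q + K * (fromℕ 2 * powℚ half N)     ≤⟨ invariant N ⟩
  K * fromℕ 2                                  ∎
  where
  open ≤-Reasoning
  open ℚ-Solver.+-*-Solver
  term≤ : ∀ i → powℚ q i * invFactorial i ≤ℚ K * powℚ half i
  term≤ i = begin
    powℚ q i * invFactorial i
      ≡⟨ *-identityˡ _ ⟨
    1ℚ * (powℚ q i * invFactorial i)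
      ≡⟨ cong (_* (powℚ q i * invFactorial i)) (trans (powℚ-distrib-* (fromℕ 2) half i) (powℚ-1 i)) ⟨
    powℚ (fromℕ 2) i * powℚ half i * (powℚ q i * invFactorial i)
      ≡⟨ solve 4 (λ A B F H → (A :* H) :* (B :* F) := A :* B :* (F :* H)) refl
                 (powℚ (fromℕ 2) i) (powℚ q i) (invFactorial i) (powℚ half i) ⟩
    powℚ (fromℕ 2) i * powℚ q i * (invFactorial i * powℚ half i)
      ≡⟨ cong (_* (invFactorial i * powℚ half i)) (powℚ-distrib-* (fromℕ 2) q i) ⟩
    powℚ (fromℕ 2 * q) i * (invFactorial i * powℚ half i)
      ≤⟨ *-monoʳ-≤-nonNeg (invFactorial i * powℚ half i)
                          {{ℚ.nonNegative (0≤* (0≤1/n (i !) {{i !≢0}}) (0≤powℚ (0≤1/n 2) i))}} ([2q]^i≤K*i! i) ⟩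
    K * fromℕ (i !) * (invFactorial i * powℚ half i)
      ≡⟨ solve 4 (λ K f F H → K :* f :* (F :* H) := (f :* F) :* (K :* H)) refl K (fromℕ (i !)) (invFactorial i) (powℚ half i) ⟩
    fromℕ (i !) * invFactorial i * (K * powℚ half i)
      ≡⟨ cong (_* (K * powℚ half i)) (fromℕ*1/n≡1 (i !) {{i !≢0}}) ⟩
    1ℚ * (K * powℚ half i)
      ≡⟨ *-identityˡ _ ⟩
    K * powℚ half i ∎
  invariant : ∀ N → expSum N q + K * (fromℕ 2 * powℚ half N) ≤ℚ K * fromℕ 2
  invariant zero    = ≤-reflexive (trans (+-identityˡ _) (cong (K *_) (*-identityʳ (fromℕ 2))))
  invariant (suc N) = begin
    expSum N q + powℚ q N * invFactorial N + K * (fromℕ 2 * (half * powℚ half N))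
      ≡⟨ cong (λ z → expSum N q + powℚ q N * invFactorial N + K * z)
              (trans (sym (*-assoc (fromℕ 2) half (powℚ half N))) (*-identityˡ (powℚ half N))) ⟩
    expSum N q + powℚ q N * invFactorial N + K * powℚ half N
      ≤⟨ +-monoˡ-≤ (K * powℚ half N) (+-monoʳ-≤ (expSum N q) (term≤ N)) ⟩
    expSum N q + K * powℚ half N + K * powℚ half N
      ≡⟨ solve 3 (λ S K P → S :+ K :* P :+ K :* P := S :+ K :* ((con 1ℚ :+ con 1ℚ) :* P)) refl (expSum N q) K (powℚ half N) ⟩
    expSum N q + K * (fromℕ 2 * powℚ half N)
      ≤⟨ invariant N ⟩
    K * fromℕ 2 ∎

expSum-half≤2 : ∀ N → expSum N half ≤ℚ fromℕ 2
expSum-half≤2 N = subst (expSum N half ≤ℚ_) (*-identityˡ (fromℕ 2)) (expSum-geometric half 1ℚ 0≤1 1≤i! N)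
  where
  1≤i! : ∀ i → powℚ (fromℕ 2 * half) i ≤ℚ 1ℚ * fromℕ (i !)
  1≤i! i = subst₂ _≤ℚ_ (sym (powℚ-1 i)) (sym (*-identityˡ _)) (fromℕ-mono-≤ (ℕ.1≤n! i))

selfPower : ℕ → ℕ
selfPower a = (2 ℕ.* a) ^ (2 ℕ.* a)

[2a]^i≤selfPower*i! : ∀ a i → (2 ℕ.* a) ^ i ≤ selfPower a ℕ.* i !
[2a]^i≤selfPower*i! a zero = subst (1 ≤_) (sym (ℕ.*-identityʳ (selfPower a))) 1≤selfPower
  where
  1≤selfPower : 1 ≤ selfPower a
  1≤selfPower with 2 ℕ.* a
  ... | zero  = ℕ.≤-refl
  ... | suc m = ℕ.m^n>0 (suc m) (suc m)
[2a]^i≤selfPower*i! a (suc i) with 2 ℕ.* a ℕ.≤? suc i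
... | yes 2a≤1+i = ℕ.≤-trans (ℕ.*-mono-≤ 2a≤1+i ([2a]^i≤selfPower*i! a i))
  (ℕ.≤-reflexive (solve 3 (λ s k f → s :* (k :* f) := k :* (s :* f)) refl (suc i) (selfPower a) (i !)))
  where open ℕ-Solver.+-*-Solver
... | no 2a≰1+i = ℕ.≤-trans (ℕ.^-monoʳ-≤ (2 ℕ.* a) {{ℕ.>-nonZero (ℕ.<-≤-trans ℕ.z<s 1+i≤2a)}} 1+i≤2a)
                             (ℕ.m≤m*n (selfPower a) (suc i !) {{suc i !≢0}})
  where
  1+i≤2a : suc i ≤ 2 ℕ.* a
  1+i≤2a = ℕ.<⇒≤ (ℕ.≰⇒> 2a≰1+i)

expSum-fromℕ≤ : ∀ a N → expSum N (fromℕ a) ≤ℚ fromℕ (2 ℕ.* selfPower a)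
expSum-fromℕ≤ a N = subst (expSum N (fromℕ a) ≤ℚ_)
  (trans (*-comm (fromℕ (selfPower a)) (fromℕ 2)) (sym (fromℕ-* 2 (selfPower a))))
  (expSum-geometric (fromℕ a) (fromℕ (selfPower a)) (0≤fromℕ _) term≤ N)
  where
  term≤ : ∀ i → powℚ (fromℕ 2 * fromℕ a) i ≤ℚ fromℕ (selfPower a) * fromℕ (i !)
  term≤ i = subst₂ _≤ℚ_ (trans (sym (powℚ-fromℕ (2 ℕ.* a) i)) (cong (λ u → powℚ u i) (fromℕ-* 2 a)))
                        (fromℕ-* (selfPower a) (i !))
                        (fromℕ-mono-≤ ([2a]^i≤selfPower*i! a i))

-- The arguments of LnCubeBound are always passed explicitly: inferring them unfolds it
-- and normalises the rationals + c / 1, which is prohibitively slow.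
lnCubeBound-apply : ∀ c n ℓ → LnCubeBound c n ℓ → ∀ {q} → 0ℚ ≤ℚ q →
                    (∀ N → expSum N q ≤ℚ fromℕ n) → fromℕ c * powℚ q 3 ≤ℚ fromℕ ℓ
lnCubeBound-apply c n ℓ bound {q} 0≤q expSum≤n =
  subst₂ (λ u v → u * powℚ q 3 ≤ℚ v) (fromℕ≡/1 c) (fromℕ≡/1 ℓ)
    (bound q 0≤q (λ N → subst (expSum N q ≤ℚ_) (sym (fromℕ≡/1 n)) (expSum≤n N)))

lnCubeBound⇒37500≤ℓ : ∀ n ℓ → 2 ≤ n → LnCubeBound 300000 n ℓ → 37500 ≤ ℓ
lnCubeBound⇒37500≤ℓ n ℓ 2≤n bound = fromℕ-cancel-≤ (subst (_≤ℚ fromℕ ℓ) 300000*half³≡37500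
  (lnCubeBound-apply 300000 n ℓ bound (0≤1/n 2) (λ N → ≤-trans (expSum-half≤2 N) (fromℕ-mono-≤ 2≤n))))
  where
  300000*half³≡37500 : fromℕ 300000 * powℚ half 3 ≡ fromℕ 37500
  300000*half³≡37500 = refl

lnCubeBound⇒cube≤ℓ : ∀ n ℓ a → 2 ℕ.* selfPower a ≤ n → LnCubeBound 300000 n ℓ → 300000 ℕ.* a ^ 3 ≤ ℓ
lnCubeBound⇒cube≤ℓ n ℓ a e^a≤n bound = fromℕ-cancel-≤
  (subst (_≤ℚ fromℕ ℓ) (trans (cong (fromℕ 300000 *_) (powℚ-fromℕ a 3)) (sym (fromℕ-* 300000 (a ^ 3))))
    (lnCubeBound-apply 300000 n ℓ bound (0≤fromℕ a) (λ N → ≤-trans (expSum-fromℕ≤ a N) (fromℕ-mono-≤ e^a≤n))))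

last-before-failure : ∀ (P : ℕ → Set) → (∀ a → Dec (P a)) → ∀ j → P 0 → ¬ P j → ∃[ a ] P a × ¬ P (suc a)
last-before-failure P P? zero    p0 ¬pj = contradiction p0 ¬pj
last-before-failure P P? (suc j) p0 ¬pj with P? j
... | yes pj  = j , pj , ¬pj
... | no  ¬pj′ = last-before-failure P P? j p0 ¬pj′

n<2^n : ∀ n → n ℕ.< 2 ^ n
n<2^n zero    = ℕ.z<s
n<2^n (suc n) = ℕ.≤-trans (ℕ.+-mono-≤ (ℕ.m^n>0 2 n) (n<2^n n)) (ℕ.≤-reflexive (cong (2 ^ n ℕ.+_) (sym (ℕ.+-identityʳ (2 ^ n)))))

n<2*selfPower : ∀ n → 1 ≤ n → n ℕ.< 2 ℕ.* selfPower n
n<2*selfPower n 1≤n = begin-strict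
  n                    ≤⟨ ℕ.m≤n*m n 2 ⟩
  2 ℕ.* n              <⟨ n<2^n (2 ℕ.* n) ⟩
  2 ^ (2 ℕ.* n)        ≤⟨ ℕ.^-monoˡ-≤ (2 ℕ.* n) (ℕ.*-monoʳ-≤ 2 1≤n) ⟩
  selfPower n          ≤⟨ ℕ.m≤n*m (selfPower n) 2 ⟩
  2 ℕ.* selfPower n    ∎
  where open ℕ.≤-Reasoning

[2+2a]²<ℓ : ∀ a ℓ → 300000 ℕ.* a ^ 3 ≤ ℓ → 37500 ≤ ℓ → suc ((2 ℕ.* suc a) ℕ.* (2 ℕ.* suc a)) ≤ ℓ
[2+2a]²<ℓ zero    ℓ _ 37500≤ℓ = ℕ.≤-trans (ℕ.m≤m+n 5 37495) 37500≤ℓ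
[2+2a]²<ℓ (suc b) ℓ cube≤ℓ _  = begin
  suc (s ℕ.* s)                                     ≤⟨ ℕ.m≤m+n _ (13 ℕ.* (b ℕ.* b) ℕ.+ 18 ℕ.* b) ⟩
  suc (s ℕ.* s) ℕ.+ (13 ℕ.* (b ℕ.* b) ℕ.+ 18 ℕ.* b)  ≡⟨ solve 1 (λ b → con 1 :+ (con 2 :* (con 2 :+ b)) :* (con 2 :* (con 2 :+ b))
                                                                       :+ (con 13 :* (b :* b) :+ con 18 :* b)
                                                                     := con 17 :* ((con 1 :+ b) :* (con 1 :+ b))) refl b ⟩
  17 ℕ.* (a ℕ.* a)                                  ≤⟨ ℕ.*-mono-≤ (ℕ.m≤m+n 17 299983) (ℕ.*-monoʳ-≤ a (ℕ.m≤m*n a a)) ⟩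
  300000 ℕ.* (a ℕ.* (a ℕ.* a))                      ≡⟨ cong (300000 ℕ.*_) (cong (a ℕ.*_) (cong (a ℕ.*_) (sym (ℕ.*-identityʳ a)))) ⟩
  300000 ℕ.* a ^ 3                                  ≤⟨ cube≤ℓ ⟩
  ℓ                                                 ∎
  where
  open ℕ.≤-Reasoning
  open ℕ-Solver.+-*-Solver
  a s : ℕ
  a = suc b
  s = 2 ℕ.* suc a

2*selfPower[1+a]≤2^ℓ : ∀ a ℓ → 300000 ℕ.* a ^ 3 ≤ ℓ → 37500 ≤ ℓ → 2 ℕ.* selfPower (suc a) ≤ 2 ^ ℓ
2*selfPower[1+a]≤2^ℓ a ℓ cube≤ℓ 37500≤ℓ = begin
  2 ℕ.* s ^ s          ≤⟨ ℕ.*-monoʳ-≤ 2 (ℕ.^-monoˡ-≤ s (ℕ.<⇒≤ (n<2^n s))) ⟩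
  2 ℕ.* (2 ^ s) ^ s    ≡⟨ cong (2 ℕ.*_) (ℕ.^-*-assoc 2 s s) ⟩
  2 ^ suc (s ℕ.* s)    ≤⟨ ℕ.^-monoʳ-≤ 2 ([2+2a]²<ℓ a ℓ cube≤ℓ 37500≤ℓ) ⟩
  2 ^ ℓ                ∎
  where
  open ℕ.≤-Reasoning
  s : ℕ
  s = 2 ℕ.* suc a

-- Take the last a with 2 (2a)^(2a) ≤ n. As e^a ≤ 2 (2a)^(2a), the hypothesis gives
-- 300000 a³ ≤ ℓ, and then n < 2 (2a+2)^(2a+2) ≤ 2^ℓ.
lnCubeBound⇒n≤2^ℓ : ∀ n ℓ → 2 ≤ n → LnCubeBound 300000 n ℓ → n ≤ 2 ^ ℓ
lnCubeBound⇒n≤2^ℓ n ℓ 2≤n bound = below (last-before-failure (λ a → 2 ℕ.* selfPower a ≤ n)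
  (λ a → 2 ℕ.* selfPower a ℕ.≤? n) n 2≤n (ℕ.<⇒≱ (n<2*selfPower n (ℕ.≤-trans (ℕ.s≤s ℕ.z≤n) 2≤n))))
  where
  below : ∃[ a ] 2 ℕ.* selfPower a ≤ n × ¬ (2 ℕ.* selfPower (suc a) ≤ n) → n ≤ 2 ^ ℓ
  below (a , e^a≤n , e^[1+a]≰n) = ℕ.<⇒≤ (ℕ.<-≤-trans (ℕ.≰⇒> e^[1+a]≰n)
    (2*selfPower[1+a]≤2^ℓ a ℓ (lnCubeBound⇒cube≤ℓ n ℓ a e^a≤n bound) (lnCubeBound⇒37500≤ℓ n ℓ 2≤n bound)))

𝔼 : ∀ {A : Set} → Dist A → (A → ℚ) → ℚ
𝔼 D f = foldr (λ x acc → proj₂ x * f (proj₁ x) + acc) 0ℚ D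

NonNegWeights : ∀ {A : Set} → Dist A → Set
NonNegWeights D = All (λ x → 0ℚ ≤ℚ proj₂ x) D

UnitMass : ∀ {A : Set} → Dist A → Set
UnitMass D = 𝔼 D (λ _ → 1ℚ) ≡ 1ℚ

module _ {A : Set} where
  open ℚ-Solver.+-*-Solver

  𝔼-cong : ∀ (D : Dist A) {f g : A → ℚ} → (∀ a → f a ≡ g a) → 𝔼 D f ≡ 𝔼 D g
  𝔼-cong []            f≗g = refl
  𝔼-cong ((a , p) ∷ D) f≗g = cong₂ (λ u v → p * u + v) (f≗g a) (𝔼-cong D f≗g)

  𝔼-mono : ∀ (D : Dist A) {f g : A → ℚ} → NonNegWeights D → (∀ a → f a ≤ℚ g a) → 𝔼 D f ≤ℚ 𝔼 D g
  𝔼-mono []            _            f≤g = ≤-refl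
  𝔼-mono ((a , p) ∷ D) (0≤p ∷ 0≤D) f≤g =
    +-mono-≤ (*-monoˡ-≤-nonNeg p {{ℚ.nonNegative 0≤p}} (f≤g a)) (𝔼-mono D 0≤D f≤g)

  𝔼-linear : ∀ (D : Dist A) α β (f g : A → ℚ) → 𝔼 D (λ a → α * f a + β * g a) ≡ α * 𝔼 D f + β * 𝔼 D g
  𝔼-linear []            α β f g = solve 2 (λ α β → con 0ℚ := α :* con 0ℚ :+ β :* con 0ℚ) refl α β
  𝔼-linear ((a , p) ∷ D) α β f g = trans (cong (_+_ (p * (α * f a + β * g a))) (𝔼-linear D α β f g))
    (solve 7 (λ p α β fa ga F G → p :* (α :* fa :+ β :* ga) :+ (α :* F :+ β :* G) := α :* (p :* fa :+ F) :+ β :* (p :* ga :+ G))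
           refl p α β (f a) (g a) (𝔼 D f) (𝔼 D g))

  𝔼-scale : ∀ (D : Dist A) c (f : A → ℚ) → 𝔼 D (λ a → c * f a) ≡ c * 𝔼 D f
  𝔼-scale []            c f = sym (*-zeroʳ c)
  𝔼-scale ((a , p) ∷ D) c f = trans (cong (_+_ (p * (c * f a))) (𝔼-scale D c f))
    (solve 4 (λ p c x y → p :* (c :* x) :+ c :* y := c :* (p :* x :+ y)) refl p c (f a) (𝔼 D f))

  𝔼-const : ∀ (D : Dist A) → UnitMass D → ∀ c → 𝔼 D (λ _ → c) ≡ c
  𝔼-const D mass c = begin
    𝔼 D (λ _ → c)         ≡⟨ 𝔼-cong D (λ _ → sym (*-identityʳ c)) ⟩
    𝔼 D (λ _ → c * 1ℚ)    ≡⟨ 𝔼-scale D c (λ _ → 1ℚ) ⟩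
    c * 𝔼 D (λ _ → 1ℚ)    ≡⟨ cong (c *_) mass ⟩
    c * 1ℚ                ≡⟨ *-identityʳ c ⟩
    c                     ∎
    where open ≡-Reasoning

  𝔼-++ : ∀ (xs ys : Dist A) f → 𝔼 (xs ++ ys) f ≡ 𝔼 xs f + 𝔼 ys f
  𝔼-++ []             ys f = sym (+-identityˡ _)
  𝔼-++ ((a , p) ∷ xs) ys f = trans (cong (_+_ (p * f a)) (𝔼-++ xs ys f)) (sym (+-assoc (p * f a) (𝔼 xs f) (𝔼 ys f)))

indicator : Bool → ℚ
indicator true  = 1ℚ
indicator false = 0ℚ

Pr≡𝔼-indicator : ∀ {A : Set} (D : Dist A) (ev : A → Bool) → Pr D ev ≡ 𝔼 D (λ a → indicator (ev a))
Pr≡𝔼-indicator []            ev = refl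
Pr≡𝔼-indicator ((a , p) ∷ D) ev with ev a
... | true  = cong₂ _+_ (sym (*-identityʳ p)) (Pr≡𝔼-indicator D ev)
... | false = cong₂ _+_ (sym (*-zeroʳ p)) (Pr≡𝔼-indicator D ev)

0≤𝔼 : ∀ {A : Set} (D : Dist A) {f : A → ℚ} → NonNegWeights D → (∀ a → 0ℚ ≤ℚ f a) → 0ℚ ≤ℚ 𝔼 D f
0≤𝔼 []            _            0≤f = ≤-refl
0≤𝔼 ((a , p) ∷ D) (0≤p ∷ 0≤D) 0≤f = +-mono-≤ (0≤* 0≤p (0≤f a)) (0≤𝔼 D 0≤D 0≤f)

0≤Pr : ∀ {A : Set} (D : Dist A) → NonNegWeights D → ∀ ev → 0ℚ ≤ℚ Pr D ev
0≤Pr D 0≤D ev = subst (0ℚ ≤ℚ_) (sym (Pr≡𝔼-indicator D ev)) (0≤𝔼 D 0≤D 0≤indicator)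
  where
  0≤indicator : ∀ a → 0ℚ ≤ℚ indicator (ev a)
  0≤indicator a with ev a
  ... | true  = 0≤1
  ... | false = ≤-refl

Pr-certain : ∀ {A : Set} (D : Dist A) → UnitMass D → ∀ ev → (∀ a → ev a ≡ true) → Pr D ev ≡ 1ℚ
Pr-certain D mass ev always = trans (Pr≡𝔼-indicator D ev)
  (trans (𝔼-cong D (λ a → cong indicator (always a))) (𝔼-const D mass 1ℚ))

markov : ∀ {A : Set} (D : Dist A) → NonNegWeights D → UnitMass D →
         ∀ (ev : A → Bool) (X : A → ℚ) {W ε} → 0ℚ < W → 0ℚ ≤ℚ ε → (∀ a → 0ℚ ≤ℚ X a) →
         𝔼 D X ≤ℚ W → (∀ a → ev a ≡ false → W ≤ℚ ε * X a) → 1ℚ - ε ≤ℚ Pr D ev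
markov D 0≤D mass ev X {W} {ε} 0<W 0≤ε 0≤X 𝔼X≤W fails⇒large =
  *-cancelˡ-≤-pos W {{ℚ.positive 0<W}} (begin
    W * (1ℚ - ε)                          ≤⟨ 0≤q-p⇒p≤q (subst (0ℚ ≤ℚ_) (sym slack) (0≤* 0≤ε (p≤q⇒0≤q-p 𝔼X≤W))) ⟩
    1ℚ * W + (- ε) * 𝔼 D X                ≡⟨ cong (λ z → 1ℚ * z + (- ε) * 𝔼 D X) (𝔼-const D mass W) ⟨
    1ℚ * 𝔼 D (λ _ → W) + (- ε) * 𝔼 D X    ≡⟨ 𝔼-linear D 1ℚ (- ε) (λ _ → W) X ⟨
    𝔼 D (λ a → 1ℚ * W + (- ε) * X a)      ≤⟨ 𝔼-mono D 0≤D pointwise ⟩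
    𝔼 D (λ a → W * indicator (ev a))      ≡⟨ 𝔼-scale D W (λ a → indicator (ev a)) ⟩
    W * 𝔼 D (λ a → indicator (ev a))      ≡⟨ cong (W *_) (Pr≡𝔼-indicator D ev) ⟨
    W * Pr D ev                           ∎)
  where
  open ≤-Reasoning
  open ℚ-Solver.+-*-Solver
  slack : 1ℚ * W + (- ε) * 𝔼 D X - W * (1ℚ - ε) ≡ ε * (W - 𝔼 D X)
  slack = solve 3 (λ W e EX → con 1ℚ :* W :+ (:- e) :* EX :- W :* (con 1ℚ :- e) := e :* (W :- EX)) refl W ε (𝔼 D X)
  pointwise : ∀ a → 1ℚ * W + (- ε) * X a ≤ℚ W * indicator (ev a)
  pointwise a with ev a in eq
  ... | true  = 0≤q-p⇒p≤q (subst (0ℚ ≤ℚ_)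
                  (sym (solve 3 (λ W e x → W :* con 1ℚ :- (con 1ℚ :* W :+ (:- e) :* x) := e :* x) refl W ε (X a)))
                  (0≤* 0≤ε (0≤X a)))
  ... | false = 0≤q-p⇒p≤q (subst (0ℚ ≤ℚ_)
                  (sym (solve 3 (λ W e x → W :* con 0ℚ :- (con 1ℚ :* W :+ (:- e) :* x) := e :* x :- W) refl W ε (X a)))
                  (p≤q⇒0≤q-p (fails⇒large a eq)))

module _ {A B : Set} (G : B × ℚ → A × ℚ) (embed : B → A) (p : ℚ) (G-scales : ∀ b q → G (b , q) ≡ (embed b , p * q)) where

  𝔼-map-scaled : ∀ (L : Dist B) (g : A → ℚ) → 𝔼 (map G L) g ≡ p * 𝔼 L (λ b → g (embed b))
  𝔼-map-scaled []            g = sym (*-zeroʳ p)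
  𝔼-map-scaled ((b , q) ∷ L) g rewrite G-scales b q | 𝔼-map-scaled L g =
    solve 4 (λ p q x y → (p :* q) :* x :+ p :* y := p :* (q :* x :+ y)) refl p q (g (embed b)) (𝔼 L (λ b → g (embed b)))
    where open ℚ-Solver.+-*-Solver

  nonNegWeights-map-scaled : 0ℚ ≤ℚ p → ∀ (L : Dist B) → NonNegWeights L → NonNegWeights (map G L)
  nonNegWeights-map-scaled 0≤p []            []            = []
  nonNegWeights-map-scaled 0≤p ((b , q) ∷ L) (0≤q ∷ 0≤L) rewrite G-scales b q =
    0≤* 0≤p 0≤q ∷ nonNegWeights-map-scaled 0≤p L 0≤L

module _ {A B : Set} (F : A × ℚ → Dist B) where

  𝔼-concatMap : ∀ (g : B → ℚ) (h : A → ℚ) → (∀ a p → 𝔼 (F (a , p)) g ≡ p * h a) →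
                ∀ (L : Dist A) → 𝔼 (concatMap F L) g ≡ 𝔼 L h
  𝔼-concatMap g h F≡ []            = refl
  𝔼-concatMap g h F≡ ((a , p) ∷ L) =
    trans (𝔼-++ (F (a , p)) _ g) (cong₂ _+_ (F≡ a p) (𝔼-concatMap g h F≡ L))

  nonNegWeights-concatMap : (∀ a p → 0ℚ ≤ℚ p → NonNegWeights (F (a , p))) →
                            ∀ (L : Dist A) → NonNegWeights L → NonNegWeights (concatMap F L)
  nonNegWeights-concatMap 0≤F []            []            = []
  nonNegWeights-concatMap 0≤F ((a , p) ∷ L) (0≤p ∷ 0≤L) =
    All.++⁺ (0≤F a p 0≤p) (nonNegWeights-concatMap 0≤F L 0≤L)

module _ {A : Set} (D : Dist A) where

  𝔼-powDist-suc : ∀ m (g : (Fin (suc m) → A) → ℚ) →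
                  𝔼 (powDist (suc m) D) g ≡ 𝔼 D (λ a → 𝔼 (powDist m D) (λ f → g (a VF.∷ f)))
  𝔼-powDist-suc m g =
    𝔼-concatMap _ g _ (λ a p → 𝔼-map-scaled _ (a VF.∷_) p (λ _ _ → refl) (powDist m D) g) D

  nonNegWeights-powDist : NonNegWeights D → ∀ m → NonNegWeights (powDist m D)
  nonNegWeights-powDist 0≤D zero    = 0≤1 ∷ []
  nonNegWeights-powDist 0≤D (suc m) = nonNegWeights-concatMap _
    (λ a p 0≤p → nonNegWeights-map-scaled _ (a VF.∷_) p (λ _ _ → refl) 0≤p (powDist m D) (nonNegWeights-powDist 0≤D m))
    D 0≤D

  unitMass-powDist : UnitMass D → ∀ m → UnitMass (powDist m D)
  unitMass-powDist mass zero    = refl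
  unitMass-powDist mass (suc m) =
    trans (𝔼-powDist-suc m (λ _ → 1ℚ)) (trans (𝔼-cong D (λ _ → unitMass-powDist mass m)) mass)

∏ : ∀ n → (Fin n → ℚ) → ℚ
∏ zero    f = 1ℚ
∏ (suc n) f = f zero * ∏ n (λ r → f (suc r))

0≤∏ : ∀ n {f : Fin n → ℚ} → (∀ r → 0ℚ ≤ℚ f r) → 0ℚ ≤ℚ ∏ n f
0≤∏ zero    0≤f = 0≤1
0≤∏ (suc n) 0≤f = 0≤* (0≤f zero) (0≤∏ n (λ r → 0≤f (suc r)))

∏-mono-≤ : ∀ n {f g : Fin n → ℚ} → (∀ r → 0ℚ ≤ℚ f r) → (∀ r → f r ≤ℚ g r) → ∏ n f ≤ℚ ∏ n g
∏-mono-≤ zero    0≤f f≤g = ≤-refl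
∏-mono-≤ (suc n) 0≤f f≤g = *-mono-≤-nonNeg (0≤f zero) (0≤∏ n (λ r → 0≤f (suc r)))
  (f≤g zero) (∏-mono-≤ n (λ r → 0≤f (suc r)) (λ r → f≤g (suc r)))

powℚ-sum : ∀ y {n} (g : Fin n → ℕ) → powℚ y (sum g) ≡ ∏ n (λ r → powℚ y (g r))
powℚ-sum y {zero}  g = refl
powℚ-sum y {suc n} g = trans (powℚ-+ y (g zero) _) (cong (powℚ y (g zero) *_) (powℚ-sum y (λ r → g (suc r))))

𝔼-powDist-∏ : ∀ {A : Set} n (D : Dist A) (h : Fin n → A → ℚ) →
              𝔼 (powDist n D) (λ ω → ∏ n (λ r → h r (ω r))) ≡ ∏ n (λ r → 𝔼 D (h r))
𝔼-powDist-∏ zero    D h = refl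
𝔼-powDist-∏ (suc n) D h = begin
  𝔼 (powDist (suc n) D) (λ ω → ∏ (suc n) (λ r → h r (ω r)))
    ≡⟨ 𝔼-powDist-suc D n _ ⟩
  𝔼 D (λ a → 𝔼 (powDist n D) (λ ω → h zero a * ∏ n (λ r → h (suc r) (ω r))))
    ≡⟨ 𝔼-cong D (λ a → 𝔼-scale (powDist n D) (h zero a) _) ⟩
  𝔼 D (λ a → h zero a * 𝔼 (powDist n D) (λ ω → ∏ n (λ r → h (suc r) (ω r))))
    ≡⟨ 𝔼-cong D (λ a → cong (h zero a *_) (𝔼-powDist-∏ n D (λ r → h (suc r)))) ⟩
  𝔼 D (λ a → h zero a * ∏ n (λ r → 𝔼 D (h (suc r))))
    ≡⟨ 𝔼-cong D (λ a → *-comm (h zero a) _) ⟩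
  𝔼 D (λ a → ∏ n (λ r → 𝔼 D (h (suc r))) * h zero a)
    ≡⟨ 𝔼-scale D (∏ n (λ r → 𝔼 D (h (suc r)))) (h zero) ⟩
  ∏ n (λ r → 𝔼 D (h (suc r))) * 𝔼 D (h zero)
    ≡⟨ *-comm _ (𝔼 D (h zero)) ⟩
  ∏ (suc n) (λ r → 𝔼 D (h r)) ∎
  where open ≡-Reasoning

module _ (ℓ : ℕ) .{{_ : NonZero ℓ}} where

  nonNegWeights-coin : NonNegWeights (coin ℓ)
  nonNegWeights-coin = 0≤1/n ℓ ∷ p≤q⇒0≤q-p (1/n≤1 ℓ) ∷ []

  unitMass-coin : UnitMass (coin ℓ)
  unitMass-coin = solve 1 (λ p → p :* con 1ℚ :+ ((con 1ℚ :- p) :* con 1ℚ :+ con 0ℚ) := con 1ℚ) refl (+ 1 / ℓ)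
    where open ℚ-Solver.+-*-Solver

  nonNegWeights-experiment : ∀ n d → NonNegWeights (experiment n d ℓ)
  nonNegWeights-experiment n d = nonNegWeights-powDist _ (nonNegWeights-powDist (coin ℓ) nonNegWeights-coin d) n

  unitMass-experiment : ∀ n d → UnitMass (experiment n d ℓ)
  unitMass-experiment n d = unitMass-powDist _ (unitMass-powDist (coin ℓ) unitMass-coin d) n

  1/ℓ^k*ℓ^k≡1 : ∀ k → powℚ (+ 1 / ℓ) k * fromℕ (ℓ ^ k) ≡ 1ℚ
  1/ℓ^k*ℓ^k≡1 zero    = refl
  1/ℓ^k*ℓ^k≡1 (suc k) = begin
    + 1 / ℓ * P * fromℕ (ℓ ^ suc k)           ≡⟨ cong (+ 1 / ℓ * P *_) (fromℕ-* ℓ (ℓ ^ k)) ⟩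
    + 1 / ℓ * P * (fromℕ ℓ * fromℕ (ℓ ^ k))   ≡⟨ solve 4 (λ p P L Q → p :* P :* (L :* Q) := (L :* p) :* (P :* Q))
                                                         refl (+ 1 / ℓ) P (fromℕ ℓ) (fromℕ (ℓ ^ k)) ⟩
    fromℕ ℓ * (+ 1 / ℓ) * (P * fromℕ (ℓ ^ k)) ≡⟨ cong₂ _*_ (fromℕ*1/n≡1 ℓ) (1/ℓ^k*ℓ^k≡1 k) ⟩
    1ℚ                                        ∎
    where
    open ≡-Reasoning
    open ℚ-Solver.+-*-Solver
    P : ℚ
    P = powℚ (+ 1 / ℓ) k

  -- k ≤ d matters: survives k f stops consulting coins after the d-th one.
  𝔼-survives : ∀ d k (φ : Bool → ℚ) → k ≤ d →
               𝔼 (powDist d (coin ℓ)) (λ f → φ (survives k f)) ≡ φ false + powℚ (+ 1 / ℓ) k * (φ true - φ false)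
  𝔼-survives d zero φ _ = begin
    𝔼 (powDist d (coin ℓ)) (λ f → φ (survives 0 f))  ≡⟨ 𝔼-cong (powDist d (coin ℓ)) (λ f → cong φ (survives-zero f)) ⟩
    𝔼 (powDist d (coin ℓ)) (λ _ → φ true)            ≡⟨ 𝔼-const (powDist d (coin ℓ)) (unitMass-powDist (coin ℓ) unitMass-coin d) (φ true) ⟩
    φ true                                           ≡⟨ solve 2 (λ T F → T := F :+ con 1ℚ :* (T :- F)) refl (φ true) (φ false) ⟩
    φ false + 1ℚ * (φ true - φ false)                ∎
    where
    open ≡-Reasoning
    open ℚ-Solver.+-*-Solver
    survives-zero : ∀ {d} (f : Fin d → Bool) → survives 0 f ≡ true
    survives-zero {zero}  f = refl
    survives-zero {suc d} f = refl
  𝔼-survives (suc d) (suc k) φ (ℕ.s≤s k≤d) = begin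
    𝔼 (powDist (suc d) (coin ℓ)) (λ f → φ (survives (suc k) f))
      ≡⟨ 𝔼-powDist-suc (coin ℓ) d _ ⟩
    p * 𝔼 (powDist d (coin ℓ)) (λ f → φ (survives k f)) + ((1ℚ - p) * 𝔼 (powDist d (coin ℓ)) (λ _ → φ false) + 0ℚ)
      ≡⟨ cong₂ (λ u v → p * u + ((1ℚ - p) * v + 0ℚ)) (𝔼-survives d k φ k≤d)
               (𝔼-const (powDist d (coin ℓ)) (unitMass-powDist (coin ℓ) unitMass-coin d) (φ false)) ⟩
    p * (φ false + P * (φ true - φ false)) + ((1ℚ - p) * φ false + 0ℚ)
      ≡⟨ solve 4 (λ p P T F → p :* (F :+ P :* (T :- F)) :+ ((con 1ℚ :- p) :* F :+ con 0ℚ) := F :+ (p :* P) :* (T :- F))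
               refl p P (φ true) (φ false) ⟩
    φ false + p * P * (φ true - φ false) ∎
    where
    open ≡-Reasoning
    open ℚ-Solver.+-*-Solver
    p P : ℚ
    p = + 1 / ℓ
    P = powℚ p k

𝟙 : Bool → ℕ
𝟙 true  = 1
𝟙 false = 0

𝟙≤1 : ∀ b → 𝟙 b ≤ 1
𝟙≤1 true  = ℕ.≤-refl
𝟙≤1 false = ℕ.z≤n

𝟙-∧ : ∀ x y → 𝟙 (x ∧ y) ≡ 𝟙 x ℕ.* 𝟙 y
𝟙-∧ true  y = sym (ℕ.+-identityʳ (𝟙 y))
𝟙-∧ false y = refl

𝟙-∧≤ : ∀ x y → 𝟙 (x ∧ y) ≤ 𝟙 x
𝟙-∧≤ true  y = 𝟙≤1 y
𝟙-∧≤ false y = ℕ.z≤n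

∣p∣≡∑𝟙 : ∀ {n} (p : Subset n) → ∣ p ∣ ≡ sum (λ r → 𝟙 (lookup p r))
∣p∣≡∑𝟙 []          = refl
∣p∣≡∑𝟙 (true ∷ p)  = cong suc (∣p∣≡∑𝟙 p)
∣p∣≡∑𝟙 (false ∷ p) = ∣p∣≡∑𝟙 p

sumℕ-cong : ∀ {I : Set} {f g : I → ℕ} (xs : List I) → (∀ i → f i ≡ g i) → sumℕ (map f xs) ≡ sumℕ (map g xs)
sumℕ-cong []       f≗g = refl
sumℕ-cong (x ∷ xs) f≗g = cong₂ ℕ._+_ (f≗g x) (sumℕ-cong xs f≗g)

sumℕ-mono-≤ : ∀ {I : Set} {f g : I → ℕ} (xs : List I) → (∀ i → f i ≤ g i) → sumℕ (map f xs) ≤ sumℕ (map g xs)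
sumℕ-mono-≤ []       f≤g = ℕ.z≤n
sumℕ-mono-≤ (x ∷ xs) f≤g = ℕ.+-mono-≤ (f≤g x) (sumℕ-mono-≤ xs f≤g)

sum-mono-≤ : ∀ {n} {f g : Fin n → ℕ} → (∀ r → f r ≤ g r) → sum f ≤ sum g
sum-mono-≤ {zero}  f≤g = ℕ.z≤n
sum-mono-≤ {suc n} f≤g = ℕ.+-mono-≤ (f≤g zero) (sum-mono-≤ (λ r → f≤g (suc r)))

module _ {n : ℕ} {I : Set} where

  multiplicity : (I → Subset n) → List I → Fin n → ℕ
  multiplicity S xs r = sumℕ (map (λ i → 𝟙 (lookup (S i) r)) xs)

  sumℕ-∣∣≡sum-multiplicity : ∀ (S : I → Subset n) xs → sumℕ (map (λ i → ∣ S i ∣) xs) ≡ sum (multiplicity S xs)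
  sumℕ-∣∣≡sum-multiplicity S []       = sym (sum-replicate-zero n)
  sumℕ-∣∣≡sum-multiplicity S (x ∷ xs) = begin
    ∣ S x ∣ ℕ.+ sumℕ (map (λ i → ∣ S i ∣) xs)           ≡⟨ cong₂ ℕ._+_ (∣p∣≡∑𝟙 (S x)) (sumℕ-∣∣≡sum-multiplicity S xs) ⟩
    sum (λ r → 𝟙 (lookup (S x) r)) ℕ.+ sum (multiplicity S xs) ≡⟨ ∑-distrib-+ (λ r → 𝟙 (lookup (S x) r)) (multiplicity S xs) ⟨
    sum (multiplicity S (x ∷ xs))                               ∎
    where open ≡-Reasoning

  multiplicity-∩ : ∀ (S : I → Subset n) (R : Subset n) xs r →
                   multiplicity (λ i → S i ∩ R) xs r ≡ multiplicity S xs r ℕ.* 𝟙 (lookup R r)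
  multiplicity-∩ S R []       r = refl
  multiplicity-∩ S R (x ∷ xs) r = begin
    𝟙 (lookup (S x ∩ R) r) ℕ.+ multiplicity (λ i → S i ∩ R) xs r
      ≡⟨ cong₂ ℕ._+_ (trans (cong 𝟙 (lookup-zipWith _∧_ r (S x) R)) (𝟙-∧ (lookup (S x) r) (lookup R r)))
                     (multiplicity-∩ S R xs r) ⟩
    𝟙 (lookup (S x) r) ℕ.* 𝟙 (lookup R r) ℕ.+ multiplicity S xs r ℕ.* 𝟙 (lookup R r)
      ≡⟨ ℕ.*-distribʳ-+ (𝟙 (lookup R r)) (𝟙 (lookup (S x) r)) (multiplicity S xs r) ⟨
    multiplicity S (x ∷ xs) r ℕ.* 𝟙 (lookup R r) ∎
    where open ≡-Reasoning

  multiplicity-filter-≤ : ∀ (S : I → Subset n) {P : I → Set} (P? : ∀ i → Dec (P i)) xs r →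
                          multiplicity S (filter P? xs) r ≤ multiplicity S xs r
  multiplicity-filter-≤ S P? []       r = ℕ.z≤n
  multiplicity-filter-≤ S P? (x ∷ xs) r with does (P? x)
  ... | true  = ℕ.+-monoʳ-≤ (𝟙 (lookup (S x) r)) (multiplicity-filter-≤ S P? xs r)
  ... | false = ℕ.≤-trans (multiplicity-filter-≤ S P? xs r) (ℕ.m≤n+m _ _)

  multiplicity≡length-filter : ∀ (S : I → Subset n) xs r → multiplicity S xs r ≡ length (filter (λ i → r ∈? S i) xs)
  multiplicity≡length-filter S []       r = refl
  multiplicity≡length-filter S (x ∷ xs) r with r ∈? S x
  ... | yes r∈Sx = cong₂ ℕ._+_ (cong 𝟙 ([]=⇒lookup r∈Sx)) (multiplicity≡length-filter S xs r)
  ... | no  r∉Sx with lookup (S x) r in eq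
  ...   | true  = contradiction (lookup⇒[]= r (S x) eq) r∉Sx
  ...   | false = multiplicity≡length-filter S xs r

≤⇒≤ᵇ≡true : ∀ {a b} → a ≤ b → (a ℕ.≤ᵇ b) ≡ true
≤⇒≤ᵇ≡true {a} {b} a≤b with a ℕ.≤ᵇ b | ℕ.≤⇒≤ᵇ a≤b
... | true | _ = refl

≤ᵇ≡false⇒> : ∀ {a b} → (a ℕ.≤ᵇ b) ≡ false → b ℕ.< a
≤ᵇ≡false⇒> a≰ᵇb = ℕ.≰⇒> (λ a≤b → contradiction (trans (sym (≤⇒≤ᵇ≡true a≤b)) a≰ᵇb) λ ())

module _ {m n c : ℕ} (ℓ k : ℕ) (𝒞 : Fin c → Config m n) (C : Config m n) where

  classMembers : List (Fin c)
  classMembers = filter (λ j → inClass ℓ k (size (𝒞 j)) Bool.≟ true) (allFin c)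

  load : Fin n → ℕ
  load = multiplicity (λ j → res (𝒞 j) ∩ res C) classMembers

  sumClass-∩≡sum-load : sumClass ℓ k 𝒞 (λ C′ → ∣ res C′ ∩ res C ∣) ≡ sum load
  sumClass-∩≡sum-load = sumℕ-∣∣≡sum-multiplicity (λ j → res (𝒞 j) ∩ res C) classMembers

  sumClass-∩-restricted : ∀ (R : Subset n) →
    sumClass ℓ k 𝒞 (λ C′ → ∣ res C′ ∩ res C ∩ R ∣) ≡ sum (λ r → load r ℕ.* 𝟙 (lookup R r))
  sumClass-∩-restricted R = begin
    sumℕ (map (λ j → ∣ res (𝒞 j) ∩ res C ∩ R ∣) classMembers)
      ≡⟨ sumℕ-cong classMembers (λ j → cong ∣_∣ (∩-assoc (res (𝒞 j)) (res C) R)) ⟨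
    sumℕ (map (λ j → ∣ (res (𝒞 j) ∩ res C) ∩ R ∣) classMembers)
      ≡⟨ sumℕ-∣∣≡sum-multiplicity (λ j → (res (𝒞 j) ∩ res C) ∩ R) classMembers ⟩
    sum (multiplicity (λ j → (res (𝒞 j) ∩ res C) ∩ R) classMembers)
      ≡⟨ sum-cong-≗ (multiplicity-∩ (λ j → res (𝒞 j) ∩ res C) R classMembers) ⟩
    sum (λ r → load r ℕ.* 𝟙 (lookup R r)) ∎
    where open ≡-Reasoning

  load≤degree : ∀ r → load r ≤ degree 𝒞 r
  load≤degree r = begin
    load r
      ≤⟨ multiplicity-filter-≤ (λ j → res (𝒞 j) ∩ res C) _ (allFin c) r ⟩
    multiplicity (λ j → res (𝒞 j) ∩ res C) (allFin c) r
      ≤⟨ sumℕ-mono-≤ (allFin c) (λ j → ℕ.≤-trans (ℕ.≤-reflexive (cong 𝟙 (lookup-zipWith _∧_ r (res (𝒞 j)) (res C))))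
                                                  (𝟙-∧≤ (lookup (res (𝒞 j)) r) (lookup (res C) r))) ⟩
    multiplicity (λ j → res (𝒞 j)) (allFin c) r
      ≡⟨ multiplicity≡length-filter (λ j → res (𝒞 j)) (allFin c) r ⟩
    degree 𝒞 r ∎
    where open ℕ.≤-Reasoning

  sumClass-restricted≤ : ∀ (R : Subset n) →
    sumClass ℓ k 𝒞 (λ C′ → ∣ res C′ ∩ res C ∩ R ∣) ≤ sumClass ℓ k 𝒞 (λ C′ → ∣ res C′ ∩ res C ∣)
  sumClass-restricted≤ R = sumℕ-mono-≤ classMembers (λ j →
    subst (_≤ ∣ res (𝒞 j) ∩ res C ∣) (cong ∣_∣ (∩-assoc (res (𝒞 j)) (res C) R)) (∣p∩q∣≤∣p∣ (res (𝒞 j) ∩ res C) R))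

goodEvent-zero : ∀ {m n c d} ℓ (𝒞 : Fin c → Config m n) (C : Config m n) (ω : Outcome n d) → goodEvent ℓ 0 𝒞 C ω ≡ true
goodEvent-zero ℓ 𝒞 C ω = ≤⇒≤ᵇ≡true (begin
  1 ℕ.* sumClass ℓ 0 𝒞 (λ C′ → ∣ res C′ ∩ res C ∩ Rk ω 0 ∣) ≡⟨ ℕ.*-identityˡ _ ⟩
  sumClass ℓ 0 𝒞 (λ C′ → ∣ res C′ ∩ res C ∩ Rk ω 0 ∣)      ≤⟨ sumClass-restricted≤ ℓ 0 𝒞 C (Rk ω 0) ⟩
  S                                                         ≤⟨ ℕ.m≤n+m S (size C) ⟩
  size C ℕ.+ S                                              ≤⟨ ℕ.m≤n*m _ 10 ⟩
  10 ℕ.* (size C ℕ.+ S)                                     ∎)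
  where
  open ℕ.≤-Reasoning
  S : ℕ
  S = sumClass ℓ 0 𝒞 (λ C′ → ∣ res C′ ∩ res C ∣)

2ℓ^[1+k]*ℓ≤ℓ^[k+3] : ∀ ℓ k → 2 ≤ ℓ → 2 ℕ.* ℓ ^ suc k ℕ.* ℓ ≤ ℓ ^ (k ℕ.+ 3)
2ℓ^[1+k]*ℓ≤ℓ^[k+3] ℓ k 2≤ℓ = begin
  2 ℕ.* ℓ ^ suc k ℕ.* ℓ       ≡⟨ solve 2 (λ X l → (con 2 :* X) :* l := X :* (con 2 :* l)) refl (ℓ ^ suc k) ℓ ⟩
  ℓ ^ suc k ℕ.* (2 ℕ.* ℓ)     ≤⟨ ℕ.*-monoʳ-≤ (ℓ ^ suc k) (ℕ.*-monoˡ-≤ ℓ 2≤ℓ) ⟩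
  ℓ ^ suc k ℕ.* (ℓ ℕ.* ℓ)     ≡⟨ solve 2 (λ l P → (l :* P) :* (l :* l) := l :* (l :* (l :* P))) refl ℓ (ℓ ^ k) ⟩
  ℓ ^ (3 ℕ.+ k)               ≡⟨ cong (ℓ ^_) (ℕ.+-comm 3 k) ⟩
  ℓ ^ (k ℕ.+ 3)               ∎
  where
  open ℕ.≤-Reasoning
  open ℕ-Solver.+-*-Solver

-- The base y = 1 + δ replaces e^λ of the usual Chernoff bound. δ = 1/(2ℓ^(k+1)) keeps
-- y^(ℓ^k u) ≤ 1 + 2ℓ^k u δ for every load u ≤ ℓ, while still y^(2ℓ^(k+1)) ≥ 2.
module Chernoff (ℓ k : ℕ) .{{_ : NonZero ℓ}} where

  private instance
    2ℓ^[1+k]≢0 : NonZero (2 ℕ.* ℓ ^ suc k)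
    2ℓ^[1+k]≢0 = ℕ.m*n≢0 2 (ℓ ^ suc k) {{_}} {{m^n≢0 ℓ (suc k)}}

  δ : ℚ
  δ = + 1 / (2 ℕ.* ℓ ^ suc k)

  y : ℚ
  y = 1ℚ + δ

  0≤δ : 0ℚ ≤ℚ δ
  0≤δ = 0≤1/n (2 ℕ.* ℓ ^ suc k)

  1≤y : 1ℚ ≤ℚ y
  1≤y = subst (_≤ℚ y) (+-identityʳ 1ℚ) (+-monoʳ-≤ 1ℚ 0≤δ)

  0≤y : 0ℚ ≤ℚ y
  0≤y = ≤-trans 0≤1 1≤y

  y^[ℓ^k*u]-1≤ : ∀ u → u ≤ ℓ → powℚ y (ℓ ^ k ℕ.* u) - 1ℚ ≤ℚ fromℕ (ℓ ^ k) * (fromℕ (2 ℕ.* u) * δ)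
  y^[ℓ^k*u]-1≤ u u≤ℓ = begin
    powℚ y c - 1ℚ                               ≤⟨ +-monoˡ-≤ (- 1ℚ) (powℚ-1+t≤1+2jt 0≤δ c 2cδ≤1) ⟩
    1ℚ + fromℕ (2 ℕ.* c) * δ - 1ℚ               ≡⟨ solve 1 (λ x → con 1ℚ :+ x :- con 1ℚ := x) refl (fromℕ (2 ℕ.* c) * δ) ⟩
    fromℕ (2 ℕ.* c) * δ                         ≡⟨ cong (_* δ) (trans (cong fromℕ 2c≡ℓ^k*2u) (fromℕ-* (ℓ ^ k) (2 ℕ.* u))) ⟩
    fromℕ (ℓ ^ k) * fromℕ (2 ℕ.* u) * δ         ≡⟨ *-assoc (fromℕ (ℓ ^ k)) (fromℕ (2 ℕ.* u)) δ ⟩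
    fromℕ (ℓ ^ k) * (fromℕ (2 ℕ.* u) * δ)       ∎
    where
    open ≤-Reasoning
    open ℚ-Solver.+-*-Solver
    c : ℕ
    c = ℓ ^ k ℕ.* u
    2c≤2ℓ^[1+k] : 2 ℕ.* c ≤ 2 ℕ.* ℓ ^ suc k
    2c≤2ℓ^[1+k] = ℕ.*-monoʳ-≤ 2 (ℕ.≤-trans (ℕ.*-monoʳ-≤ (ℓ ^ k) u≤ℓ) (ℕ.≤-reflexive (ℕ.*-comm (ℓ ^ k) ℓ)))
    2cδ≤1 : fromℕ (2 ℕ.* c) * δ ≤ℚ 1ℚ
    2cδ≤1 = subst (fromℕ (2 ℕ.* c) * δ ≤ℚ_) (fromℕ*1/n≡1 (2 ℕ.* ℓ ^ suc k))
                  (*-monoʳ-≤-nonNeg δ {{ℚ.nonNegative 0≤δ}} (fromℕ-mono-≤ 2c≤2ℓ^[1+k]))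
    2c≡ℓ^k*2u : 2 ℕ.* c ≡ ℓ ^ k ℕ.* (2 ℕ.* u)
    2c≡ℓ^k*2u = trans (ℕ.*-comm 2 c) (trans (ℕ.*-assoc (ℓ ^ k) u 2) (cong (ℓ ^ k ℕ.*_) (ℕ.*-comm u 2)))

  survival-mgf≤ : ∀ d u → k ≤ d → u ≤ ℓ →
    𝔼 (powDist d (coin ℓ)) (λ f → powℚ y (ℓ ^ k ℕ.* (u ℕ.* 𝟙 (survives k f)))) ≤ℚ powℚ y (2 ℕ.* u)
  survival-mgf≤ d u k≤d u≤ℓ = begin
    𝔼 (powDist d (coin ℓ)) (λ f → φ (survives k f))   ≡⟨ 𝔼-survives ℓ d k φ k≤d ⟩
    φ false + P * (φ true - φ false)                  ≡⟨ cong₂ (λ a b → a + P * (b - a)) φ-false≡1 φ-true≡ ⟩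
    1ℚ + P * (powℚ y (ℓ ^ k ℕ.* u) - 1ℚ)              ≤⟨ +-monoʳ-≤ 1ℚ (*-monoˡ-≤-nonNeg P {{ℚ.nonNegative (0≤powℚ (0≤1/n ℓ) k)}}
                                                                                    (y^[ℓ^k*u]-1≤ u u≤ℓ)) ⟩
    1ℚ + P * (fromℕ (ℓ ^ k) * (fromℕ (2 ℕ.* u) * δ))  ≡⟨ cong (_+_ 1ℚ) (trans (sym (*-assoc P (fromℕ (ℓ ^ k)) (fromℕ (2 ℕ.* u) * δ)))
                                                                           (trans (cong (_* (fromℕ (2 ℕ.* u) * δ)) (1/ℓ^k*ℓ^k≡1 ℓ k))
                                                                                  (*-identityˡ (fromℕ (2 ℕ.* u) * δ)))) ⟩
    1ℚ + fromℕ (2 ℕ.* u) * δ                          ≤⟨ bernoulli 0≤δ (2 ℕ.* u) ⟩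
    powℚ y (2 ℕ.* u)                                  ∎
    where
    open ≤-Reasoning
    φ : Bool → ℚ
    φ b = powℚ y (ℓ ^ k ℕ.* (u ℕ.* 𝟙 b))
    P : ℚ
    P = powℚ (+ 1 / ℓ) k
    φ-false≡1 : φ false ≡ 1ℚ
    φ-false≡1 = cong (powℚ y) (trans (cong (ℓ ^ k ℕ.*_) (ℕ.*-zeroʳ u)) (ℕ.*-zeroʳ (ℓ ^ k)))
    φ-true≡ : φ true ≡ powℚ y (ℓ ^ k ℕ.* u)
    φ-true≡ = cong (λ z → powℚ y (ℓ ^ k ℕ.* z)) (ℕ.*-identityʳ u)

  n^10≤y^[10s] : ∀ n s → 2 ≤ ℓ → n ≤ 2 ^ ℓ → ℓ ^ (k ℕ.+ 3) ≤ s → fromℕ (n ^ 10) ≤ℚ powℚ y (s ℕ.* 10)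
  n^10≤y^[10s] n s 2≤ℓ n≤2^ℓ ℓ^[k+3]≤s = begin
    fromℕ (n ^ 10)   ≡⟨ powℚ-fromℕ n 10 ⟨
    powℚ (fromℕ n) 10 ≤⟨ powℚ-monoˡ-≤ (0≤fromℕ n) n≤y^s 10 ⟩
    powℚ (powℚ y s) 10 ≡⟨ powℚ-* y s 10 ⟨
    powℚ y (s ℕ.* 10) ∎
    where
    open ≤-Reasoning
    M : ℕ
    M = 2 ℕ.* ℓ ^ suc k
    2≤y^M : fromℕ 2 ≤ℚ powℚ y M
    2≤y^M = subst (_≤ℚ powℚ y M) (cong (_+_ 1ℚ) (fromℕ*1/n≡1 M)) (bernoulli 0≤δ M)
    Mℓ≤s : M ℕ.* ℓ ≤ s
    Mℓ≤s = ℕ.≤-trans (2ℓ^[1+k]*ℓ≤ℓ^[k+3] ℓ k 2≤ℓ) ℓ^[k+3]≤s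
    n≤y^s : fromℕ n ≤ℚ powℚ y s
    n≤y^s = begin
      fromℕ n              ≤⟨ fromℕ-mono-≤ n≤2^ℓ ⟩
      fromℕ (2 ^ ℓ)        ≡⟨ powℚ-fromℕ 2 ℓ ⟨
      powℚ (fromℕ 2) ℓ     ≤⟨ powℚ-monoˡ-≤ (0≤fromℕ 2) 2≤y^M ℓ ⟩
      powℚ (powℚ y M) ℓ    ≡⟨ powℚ-* y M ℓ ⟨
      powℚ y (M ℕ.* ℓ)     ≤⟨ powℚ-monoʳ-≤ 1≤y Mℓ≤s ⟩
      powℚ y s             ∎

  module _ {m n c d : ℕ} (𝒞 : Fin c → Config m n) (C : Config m n) where

    hits : Outcome n d → ℕ
    hits ω = sumClass ℓ k 𝒞 (λ C′ → ∣ res C′ ∩ res C ∩ Rk ω k ∣)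

    hits≡ : ∀ ω → hits ω ≡ sum (λ r → load ℓ k 𝒞 C r ℕ.* 𝟙 (survives k (ω r)))
    hits≡ ω = trans (sumClass-∩-restricted ℓ k 𝒞 C (Rk ω k))
      (sum-cong-≗ (λ r → cong (λ b → load ℓ k 𝒞 C r ℕ.* 𝟙 b) (lookup∘tabulate (λ r → survives k (ω r)) r)))

    mgf-hits≤ : (∀ r → load ℓ k 𝒞 C r ≤ ℓ) → k ≤ d →
      𝔼 (experiment n d ℓ) (λ ω → powℚ y (ℓ ^ k ℕ.* hits ω)) ≤ℚ powℚ y (2 ℕ.* sum (load ℓ k 𝒞 C))
    mgf-hits≤ load≤ℓ k≤d = begin
      𝔼 (experiment n d ℓ) (λ ω → powℚ y (ℓ ^ k ℕ.* hits ω))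
        ≡⟨ 𝔼-cong (experiment n d ℓ) factorise ⟩
      𝔼 (experiment n d ℓ) (λ ω → ∏ n (λ r → φ r (ω r)))
        ≡⟨ 𝔼-powDist-∏ n (powDist d (coin ℓ)) φ ⟩
      ∏ n (λ r → 𝔼 (powDist d (coin ℓ)) (φ r))
        ≤⟨ ∏-mono-≤ n (λ r → 0≤𝔼 (powDist d (coin ℓ)) (nonNegWeights-powDist (coin ℓ) (nonNegWeights-coin ℓ) d)
                                             (λ f → 0≤powℚ 0≤y (ℓ ^ k ℕ.* (u r ℕ.* 𝟙 (survives k f)))))
                      (λ r → survival-mgf≤ d (u r) k≤d (load≤ℓ r)) ⟩
      ∏ n (λ r → powℚ y (2 ℕ.* u r))
        ≡⟨ powℚ-sum y (λ r → 2 ℕ.* u r) ⟨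
      powℚ y (sum (λ r → 2 ℕ.* u r))
        ≡⟨ cong (powℚ y) (*-distribˡ-sum 2 u) ⟨
      powℚ y (2 ℕ.* sum u) ∎
      where
      open ≤-Reasoning
      u : Fin n → ℕ
      u = load ℓ k 𝒞 C
      φ : Fin n → (Fin d → Bool) → ℚ
      φ r f = powℚ y (ℓ ^ k ℕ.* (u r ℕ.* 𝟙 (survives k f)))
      factorise : ∀ ω → powℚ y (ℓ ^ k ℕ.* hits ω) ≡ ∏ n (λ r → φ r (ω r))
      factorise ω = trans (cong (λ z → powℚ y (ℓ ^ k ℕ.* z)) (hits≡ ω))
        (trans (cong (powℚ y) (*-distribˡ-sum (ℓ ^ k) (λ r → u r ℕ.* 𝟙 (survives k (ω r)))))
               (powℚ-sum y (λ r → ℓ ^ k ℕ.* (u r ℕ.* 𝟙 (survives k (ω r))))))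

    hits-large-on-failure : ∀ ω → goodEvent ℓ k 𝒞 C ω ≡ false →
                            2 ℕ.* sum (load ℓ k 𝒞 C) ℕ.+ size C ℕ.* 10 ≤ ℓ ^ k ℕ.* hits ω
    hits-large-on-failure ω fails = begin
      2 ℕ.* S ℕ.+ size C ℕ.* 10               ≤⟨ ℕ.m≤m+n _ (8 ℕ.* S) ⟩
      2 ℕ.* S ℕ.+ size C ℕ.* 10 ℕ.+ 8 ℕ.* S   ≡⟨ solve 2 (λ s cC → con 2 :* s :+ cC :* con 10 :+ con 8 :* s := con 10 :* (cC :+ s)) refl S (size C) ⟩
      10 ℕ.* (size C ℕ.+ S)                    ≡⟨ cong (λ z → 10 ℕ.* (size C ℕ.+ z)) (sumClass-∩≡sum-load ℓ k 𝒞 C) ⟨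
      10 ℕ.* (size C ℕ.+ sumClass ℓ k 𝒞 (λ C′ → ∣ res C′ ∩ res C ∣))
                                               <⟨ ≤ᵇ≡false⇒> fails ⟩
      ℓ ^ k ℕ.* hits ω                         ∎
      where
      open ℕ.≤-Reasoning
      open ℕ-Solver.+-*-Solver
      S : ℕ
      S = sum (load ℓ k 𝒞 C)

    mgf-large-on-failure : 2 ≤ ℓ → n ≤ 2 ^ ℓ → ℓ ^ (k ℕ.+ 3) ≤ size C → ∀ ω → goodEvent ℓ k 𝒞 C ω ≡ false →
      powℚ y (2 ℕ.* sum (load ℓ k 𝒞 C)) * fromℕ (n ^ 10) ≤ℚ powℚ y (ℓ ^ k ℕ.* hits ω)
    mgf-large-on-failure 2≤ℓ n≤2^ℓ ℓ^[k+3]≤|C| ω fails = begin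
      powℚ y (2 ℕ.* S) * fromℕ (n ^ 10)          ≤⟨ *-monoˡ-≤-nonNeg (powℚ y (2 ℕ.* S)) {{ℚ.nonNegative (0≤powℚ 0≤y (2 ℕ.* S))}}
                                                                     (n^10≤y^[10s] n (size C) 2≤ℓ n≤2^ℓ ℓ^[k+3]≤|C|) ⟩
      powℚ y (2 ℕ.* S) * powℚ y (size C ℕ.* 10)  ≡⟨ powℚ-+ y (2 ℕ.* S) (size C ℕ.* 10) ⟨
      powℚ y (2 ℕ.* S ℕ.+ size C ℕ.* 10)         ≤⟨ powℚ-monoʳ-≤ 1≤y (hits-large-on-failure ω fails) ⟩
      powℚ y (ℓ ^ k ℕ.* hits ω)                  ∎
      where
      open ≤-Reasoning
      S : ℕ
      S = sum (load ℓ k 𝒞 C)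

    goodEvent-whp : .{{_ : NonZero n}} → (∀ r → load ℓ k 𝒞 C r ≤ ℓ) → 2 ≤ ℓ → n ≤ 2 ^ ℓ → k ≤ d →
                    ℓ ^ (k ℕ.+ 3) ≤ size C →
                    1ℚ - (+ 1 / (n ^ 10)) {{m^n≢0 n 10}} ≤ℚ Pr (experiment n d ℓ) (goodEvent ℓ k 𝒞 C)
    goodEvent-whp load≤ℓ 2≤ℓ n≤2^ℓ k≤d ℓ^[k+3]≤|C| =
      markov (experiment n d ℓ) (nonNegWeights-experiment ℓ n d) (unitMass-experiment ℓ n d)
             (goodEvent ℓ k 𝒞 C) (λ ω → powℚ y (ℓ ^ k ℕ.* hits ω)) 0<W (0≤1/n (n ^ 10))
             (λ ω → 0≤powℚ 0≤y (ℓ ^ k ℕ.* hits ω)) (mgf-hits≤ load≤ℓ k≤d) W≤εX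
      where
      instance
        n^10≢0 : NonZero (n ^ 10)
        n^10≢0 = m^n≢0 n 10
      W ε : ℚ
      W = powℚ y (2 ℕ.* sum (load ℓ k 𝒞 C))
      ε = + 1 / (n ^ 10)
      0<W : 0ℚ < W
      0<W = <-≤-trans (ℚ.*<* (ℤ.+<+ ℕ.z<s)) (1≤powℚ 1≤y (2 ℕ.* sum (load ℓ k 𝒞 C)))
      W≤εX : ∀ ω → goodEvent ℓ k 𝒞 C ω ≡ false → W ≤ℚ ε * powℚ y (ℓ ^ k ℕ.* hits ω)
      W≤εX ω fails = begin
        W                               ≡⟨ trans (cong (W *_) (fromℕ*1/n≡1 (n ^ 10))) (*-identityʳ W) ⟨
        W * (fromℕ (n ^ 10) * ε)        ≡⟨ *-assoc W (fromℕ (n ^ 10)) ε ⟨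
        W * fromℕ (n ^ 10) * ε          ≤⟨ *-monoʳ-≤-nonNeg ε {{ℚ.nonNegative (0≤1/n (n ^ 10))}}
                                                            (mgf-large-on-failure 2≤ℓ n≤2^ℓ ℓ^[k+3]≤|C| ω fails) ⟩
        powℚ y (ℓ ^ k ℕ.* hits ω) * ε   ≡⟨ *-comm _ ε ⟩
        ε * powℚ y (ℓ ^ k ℕ.* hits ω)   ∎
        where open ≤-Reasoning

p-q≤p : ∀ {p q} → 0ℚ ≤ℚ q → p - q ≤ℚ p
p-q≤p {p} {q} 0≤q = 0≤q-p⇒p≤q (subst (0ℚ ≤ℚ_) (solve 2 (λ p q → q := p :- (p :- q)) refl p q) 0≤q)
  where open ℚ-Solver.+-*-Solver

inAtLeast⇒≤depth : ∀ {m n c ℓ d k} (𝒞 : Fin c → Config m n) i → IsDepth ℓ 𝒞 d → InAtLeast ℓ k (size (𝒞 i)) → k ≤ d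
inAtLeast⇒≤depth 𝒞 i (empty-from-d , _) (h , k≤h , inClass-h) =
  ℕ.≮⇒≥ (λ d<k → empty-from-d i (h , ℕ.≤-trans (ℕ.<⇒≤ d<k) k≤h , inClass-h))

inAtLeast⇒ℓ^[k+3]≤ : ∀ ℓ .{{_ : NonZero ℓ}} k {s} → InAtLeast ℓ (suc k) s → ℓ ^ (suc k ℕ.+ 3) ≤ s
inAtLeast⇒ℓ^[k+3]≤ ℓ k {s} (suc h , ℕ.s≤s k≤h , inClass-h) =
  ℕ.≤-trans (ℕ.^-monoʳ-≤ ℓ (ℕ.+-monoˡ-≤ 3 (ℕ.s≤s k≤h))) (lower-bound inClass-h)
  where
  lower-bound : ∀ {b} → ((ℓ ^ (suc h ℕ.+ 3) ℕ.≤ᵇ s) ∧ b) ≡ true → ℓ ^ (suc h ℕ.+ 3) ≤ s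
  lower-bound _ with ℓ ^ (suc h ℕ.+ 3) ℕ.≤ᵇ s in ℓ^[h+4]≤ᵇs
  ... | true = ℕ.≤ᵇ⇒≤ (ℓ ^ (suc h ℕ.+ 3)) s (subst T (sym ℓ^[h+4]≤ᵇs) _)

lemma5 : (m n c ℓ d : ℕ) → .{{_ : NonZero n}} → .{{_ : NonZero ℓ}}
         → (𝒞 : Fin c → Config m n)
         → (∀ (r : Fin n) → degree 𝒞 r ≤ ℓ)
         → IsDepth ℓ 𝒞 d
         → LnCubeBound 300000 n ℓ
         → (k : ℕ) → (i : Fin c) → InAtLeast ℓ k (size (𝒞 i))
         → (1ℚ - ((+ 1 / (n ^ 10)) {{m^n≢0 n 10}}))
             ≤ℚ Pr (experiment n d ℓ) (goodEvent ℓ k 𝒞 (𝒞 i))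
-- For n = 1 the claimed bound 1 - 1/n^10 is 0.
lemma5 m 1 c ℓ d 𝒞 _ _ _ k i _ =
  0≤Pr (experiment 1 d ℓ) (nonNegWeights-experiment ℓ 1 d) (goodEvent ℓ k 𝒞 (𝒞 i))
lemma5 m n@(suc (suc _)) c ℓ d 𝒞 _ _ _ zero i _ =
  ≤-trans (p-q≤p (0≤1/n (n ^ 10) {{m^n≢0 n 10}}))
          (≤-reflexive (sym (Pr-certain (experiment n d ℓ) (unitMass-experiment ℓ n d) _ (goodEvent-zero ℓ 𝒞 (𝒞 i)))))
lemma5 m n@(suc (suc _)) c ℓ d 𝒞 degree≤ℓ depth lnBound k@(suc k′) i inAtLeast =
  Chernoff.goodEvent-whp ℓ k 𝒞 (𝒞 i)
    (λ r → ℕ.≤-trans (load≤degree ℓ k 𝒞 (𝒞 i) r) (degree≤ℓ r))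
    (ℕ.≤-trans (ℕ.m≤m+n 2 37498) (lnCubeBound⇒37500≤ℓ n ℓ 2≤n lnBound))
    (lnCubeBound⇒n≤2^ℓ n ℓ 2≤n lnBound)
    (inAtLeast⇒≤depth 𝒞 i depth inAtLeast)
    (inAtLeast⇒ℓ^[k+3]≤ ℓ k′ inAtLeast)
  where
  2≤n : 2 ≤ n
  2≤n = ℕ.s≤s (ℕ.s≤s ℕ.z≤n)
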